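{- If $p>2$ is prime, then $\Gamma^{\mathrm{sym}}(\mathbb{F}_p^n)$ is not a monoidal network for any $n\geq 1$.
   Context: Rings are commutative with identity; $\mathrm{Aut}(R)$ is the ring automorphism group and $R^{\mathrm{Aut}(R)}$ the subring fixed by all automorphisms. For a group $G$ acting on a set $X$ and $S\subseteq X$, $G^S$ is the setwise stabilizer. The symmetric multiaction $\Gamma^{\mathrm{sym}}(R)$ assigns to each ideal $I$ of $R$ the group $\Gamma_I=\mathrm{Sym}(R/I)$ acting naturally on $R/I$ (so $\Gamma_0=\mathrm{Sym}(R)$). An extended submonoid of $R$ is a multiplicatively closed subset $M\subseteq R$ with $1\in M$ and $R^{\mathrm{Aut}(R)}\subseteq M$. An ideal $I$ with projection $\pi:R\to R/I$ is a covering ideal of $M$ if there is an extended submonoid $\hat M\subseteq M$ with $M\setminus\hat M\subseteq I$ such that for every $g\in\Gamma_I^{\pi(\hat M)}$ there is $\tilde g\in\Gamma_0^{\hat M}$ with $\pi(\tilde g(x))=g(\pi(x))$ for all $x\in\hat M$. The multiaction is a monoidal network if every extended submonoid of $R$ has a proper, nonzero covering ideal. -}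

module Defs where

open import Level using (0ℓ)
open import Data.Nat using (ℕ; NonZero)
import Data.Nat as ℕ
open import Data.Nat.DivMod using (_mod_)
open import Data.Nat.Primality using (Prime; prime⇒nonZero)
open import Data.Fin using (Fin; toℕ)
open import Data.Vec using (Vec; zipWith; map; replicate)
open import Data.Product using (Σ; ∃; _×_)
open import Relation.Nullary using (¬_)
open import Relation.Binary.PropositionalEquality using (_≡_)
open import Algebra.Bundles.Raw using (RawRing)

module RingNotions (𝓡 : RawRing 0ℓ 0ℓ) where
  open RawRing 𝓡 renaming (Carrier to R)

  Subset : Set₁
  Subset = R → Set

  record IsAutomorphism (f : R → R) : Set where
    field
      inv    : R → R
      cong   : ∀ {x y} → x ≈ y → f x ≈ f y
      invˡ   : ∀ x → inv (f x) ≈ x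
      invʳ   : ∀ x → f (inv x) ≈ x
      +-hom  : ∀ x y → f (x + y) ≈ f x + f y
      *-hom  : ∀ x y → f (x * y) ≈ f x * f y
      1-hom  : f 1# ≈ 1#

  FixedByAut : Subset
  FixedByAut x = ∀ f → IsAutomorphism f → f x ≈ x

  record IsExtendedSubmonoid (M : Subset) : Set where
    field
      one∈     : M 1#
      *-closed : ∀ {x y} → M x → M y → M (x * y)
      fixed⊆   : ∀ {x} → FixedByAut x → M x

  record IsIdeal (I : Subset) : Set where
    field
      resp     : ∀ {x y} → x ≈ y → I x → I y
      zero∈    : I 0#
      +-closed : ∀ {x y} → I x → I y → I (x + y)
      neg-closed : ∀ {x} → I x → I (- x)
      absorb   : ∀ r {x} → I x → I (r * x)

  Proper : Subset → Set
  Proper I = ¬ I 1#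

  Nonzero : Subset → Set
  Nonzero I = ∃ λ x → I x × ¬ (x ≈ 0#)

  _∼[_]_ : R → Subset → R → Set
  x ∼[ I ] y = I (x + (- y))

  record IsPerm (g : R → R) : Set where
    field
      inv  : R → R
      cong : ∀ {x y} → x ≈ y → g x ≈ g y
      invˡ : ∀ x → inv (g x) ≈ x
      invʳ : ∀ x → g (inv x) ≈ x

  record Stabilizes (S : Subset) (g : R → R) : Set where
    field
      image⊆ : ∀ {x} → S x → S (g x)
      ⊆image : ∀ {y} → S y → ∃ λ x → S x × (g x ≈ y)

  -- Γ_I = Sym(R/I): a permutation of R/I, represented by a map
  -- g : R → R that is well defined on classes and induces a bijection
  -- of R/I  (the induced map is  π x ↦ π (g x)).
  record IsQuotPerm (I : Subset) (g : R → R) : Set where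
    field
      wd   : ∀ {x y} → x ∼[ I ] y → g x ∼[ I ] g y
      inj  : ∀ {x y} → g x ∼[ I ] g y → x ∼[ I ] y
      surj : ∀ y → ∃ λ x → g x ∼[ I ] y

  record QuotStabilizes (I : Subset) (S : Subset) (g : R → R) : Set where
    field
      image⊆ : ∀ {x} → S x → ∃ λ y → S y × (g x ∼[ I ] y)
      ⊆image : ∀ {y} → S y → ∃ λ x → S x × (g x ∼[ I ] y)

  IsCoveringIdeal : Subset → Subset → Set₁
  IsCoveringIdeal M I =
    Σ Subset λ M̂ →
      IsExtendedSubmonoid M̂ ×
      (∀ {x} → M̂ x → M x) ×
      (∀ {x} → M x → ¬ M̂ x → I x) ×
      (∀ g → IsQuotPerm I g → QuotStabilizes I M̂ g →
         ∃ λ g̃ → IsPerm g̃ × Stabilizes M̂ g̃ ×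
                 (∀ {x} → M̂ x → g̃ x ∼[ I ] g x))

  IsMonoidalNetwork : Set₁
  IsMonoidalNetwork =
    ∀ M → IsExtendedSubmonoid M →
      ∃ λ I → IsIdeal I × Proper I × Nonzero I × IsCoveringIdeal M I

module _ (p : ℕ) (pr : Prime p) where
  private instance
    nz : NonZero p
    nz = prime⇒nonZero pr

  addₚ mulₚ : Fin p → Fin p → Fin p
  addₚ a b = (toℕ a ℕ.+ toℕ b) mod p
  mulₚ a b = (toℕ a ℕ.* toℕ b) mod p

  negₚ : Fin p → Fin p
  negₚ a = (p ℕ.∸ toℕ a) mod p

  Fpⁿ : ℕ → RawRing 0ℓ 0ℓ
  Fpⁿ n = record
    { Carrier = Vec (Fin p) n
    ; _≈_     = _≡_
    ; _+_     = zipWith addₚ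
    ; _*_     = zipWith mulₚ
    ; -_      = map negₚ
    ; 0#      = replicate n (0 mod p)
    ; 1#      = replicate n (1 mod p)
    }

module Submission where

-- Let R = 𝔽ₚⁿ (n ≥ 1, p an odd prime) and let M be the set of
-- vectors that are either zero or have all coordinates nonzero, i.e. M = R^× ∪ {0}.
-- M is an extended submonoid: coordinate permutations are automorphisms, so
-- every Aut(R)-fixed vector is constant and hence lies in M.  Suppose I is a
-- proper nonzero covering ideal of M, witnessed by M̂ ⊆ M, and pick 0 ≠ x₀ ∈ I.
-- Because p > 2 there is a unit u such that b = u + x₀ is again a unit; units
-- avoid the proper ideal I, so u, b ∈ M̂ and u ≡ b (mod I) although u ≠ b.
-- The permutation of R/I swapping the classes of 0 and u stabilises π(M̂); a
-- lift g̃ of it sends both u and b into M̂ ∩ I = {0}, so u = b, a contradiction.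

open import Level using (0ℓ)
open import Function using (_∘_)
open import Data.Nat using (ℕ; zero; suc; _<_; _≤_; NonZero; nonTrivial⇒n>1; >-nonZero⁻¹)
open import Data.Nat.Properties
  using (_≟_; 1+n≢0; +-assoc; +-comm; +-identityʳ; *-assoc; *-comm; *-distribʳ-+; m+[n∸m]≡n; <⇒≤; <⇒≱)
open import Data.Nat.DivMod using (_mod_; %-distribˡ-+; %-distribˡ-*; [m+n]%n≡m%n; [m+kn]%n≡m%n; m<n⇒m%n≡m)
open import Data.Nat.Divisibility using (_∣_; m%n≡0⇒n∣m; >⇒∤; ∣⇒≤)
open import Data.Nat.Primality using (Prime; prime⇒nonZero; prime⇒nonTrivial; prime⇒irreducible; euclidsLemma)
open import Data.Nat.Coprimality using (Coprime; coprime-Bézout)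
open import Data.Nat.GCD using (module Bézout)
open import Data.Nat.Tactic.RingSolver using (solve-∀)
open import Data.Fin using (Fin; zero; suc; toℕ)
open import Data.Fin.Properties using (toℕ-fromℕ<; fromℕ<-cong; toℕ<n; toℕ-injective)
open import Data.Fin.Permutation using (Permutation′; _⟨$⟩ʳ_; flip; transpose)
  renaming (inverseˡ to permutation-inverseˡ; inverseʳ to permutation-inverseʳ)
open import Data.Vec using (Vec; []; _∷_; lookup; tabulate; zipWith; replicate)
open import Data.Vec.Properties
  using (lookup∘tabulate; tabulate∘lookup; tabulate-cong; lookup-zipWith; lookup-replicate;
         zipWith-assoc; zipWith-comm; zipWith-identityˡ; zipWith-identityʳ;
         zipWith-inverseˡ; zipWith-inverseʳ; zipWith-zeroˡ; zipWith-zeroʳ)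
open import Data.Product using (∃; _×_; _,_; proj₁; proj₂)
open import Data.Sum using (_⊎_; inj₁; inj₂; [_,_]′)
open import Relation.Nullary using (¬_; Dec; yes; no; contradiction)
open import Relation.Nullary.Decidable using (¬¬-excluded-middle)
open import Relation.Unary using () renaming (Decidable to DecidablePred)
open import Relation.Binary.Core using (Rel)
open import Relation.Binary.Definitions using (Decidable; Substitutive)
open import Relation.Binary.Structures using (IsEquivalence)
open import Relation.Binary.PropositionalEquality
  using (_≡_; _≢_; refl; sym; trans; subst; cong; cong₂; isEquivalence; module ≡-Reasoning)
open import Algebra.Bundles using (AbelianGroup)
open import Algebra.Bundles.Raw using (RawRing)
open import Algebra.Structures using (IsAbelianGroup)
import Algebra.Properties.AbelianGroup as AbelianGroupProperties
import Relation.Binary.Reasoning.Setoid as SetoidReasoning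
open import Defs

-- Double-negation shift over finite types

DNShift : Set → Set₁
DNShift A = (P : A → Set) → (∀ x → ¬ ¬ P x) → ¬ ¬ (∀ x → P x)

fin-dnShift : ∀ k → DNShift (Fin k)
fin-dnShift zero    P pointwise ¬all = ¬all λ ()
fin-dnShift (suc k) P pointwise ¬all =
  pointwise zero λ P0 →
  fin-dnShift k (P ∘ suc) (pointwise ∘ suc) λ Psuc →
  ¬all λ { zero → P0 ; (suc i) → Psuc i }

vec-dnShift : ∀ {A} → DNShift A → ∀ k → DNShift (Vec A k)
vec-dnShift shift zero    P pointwise ¬all = pointwise [] λ P[] → ¬all λ { [] → P[] }
vec-dnShift shift (suc k) P pointwise ¬all =
  shift (λ a → ∀ v → P (a ∷ v)) (λ a → vec-dnShift shift k (P ∘ (a ∷_)) (pointwise ∘ (a ∷_)))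
  λ Pcons → ¬all λ { (a ∷ v) → Pcons a v }

-- Any predicate on vectors over such a type (e.g. membership in an ideal of
-- 𝔽ₚⁿ) may be assumed decidable when proving a negative statement.
¬¬-decidable : ∀ {A k} → DNShift A → (P : Vec A k → Set) → ¬ ¬ (∀ x → Dec (P x))
¬¬-decidable {k = k} shift P = vec-dnShift shift k (Dec ∘ P) (λ _ → ¬¬-excluded-middle)

-- Swapping two classes of a decidable equivalence relation

module ClassSwap {A : Set} {_∼_ : Rel A 0ℓ} (∼-isEquivalence : IsEquivalence _∼_)
                 (_∼?_ : Decidable _∼_) {a c : A} (a≁c : ¬ a ∼ c) where
  open IsEquivalence ∼-isEquivalence
    renaming (refl to ∼-refl; sym to ∼-sym; trans to ∼-trans; reflexive to ∼-reflexive)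

  data Position (x : A) : Set where
    in-a      : x ∼ a → Position x
    in-c      : ¬ x ∼ a → x ∼ c → Position x
    elsewhere : ¬ x ∼ a → ¬ x ∼ c → Position x

  position : ∀ x → Position x
  position x with x ∼? a | x ∼? c
  ... | yes x∼a | _       = in-a x∼a
  ... | no x≁a  | yes x∼c = in-c x≁a x∼c
  ... | no x≁a  | no x≁c  = elsewhere x≁a x≁c

  swap : A → A
  swap x with position x
  ... | in-a _        = c
  ... | in-c _ _      = a
  ... | elsewhere _ _ = x

  swap-on-a : ∀ {x} → x ∼ a → swap x ≡ c
  swap-on-a {x} x∼a with position x
  ... | in-a _          = refl
  ... | in-c x≁a _      = contradiction x∼a x≁a
  ... | elsewhere x≁a _ = contradiction x∼a x≁a

  swap-on-c : ∀ {x} → x ∼ c → swap x ≡ a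
  swap-on-c {x} x∼c with position x
  ... | in-a x∼a        = contradiction (∼-trans (∼-sym x∼a) x∼c) a≁c
  ... | in-c _ _        = refl
  ... | elsewhere _ x≁c = contradiction x∼c x≁c

  -- congruent points lie in the same class, so they are moved alike
  swap-resp : ∀ {x y} → x ∼ y → swap x ∼ swap y
  swap-resp {x} {y} x∼y with position x
  ... | in-a x∼a   = ∼-reflexive (sym (swap-on-a (∼-trans (∼-sym x∼y) x∼a)))
  ... | in-c _ x∼c = ∼-reflexive (sym (swap-on-c (∼-trans (∼-sym x∼y) x∼c)))
  ... | elsewhere x≁a x≁c with position y
  ...   | in-a y∼a      = contradiction (∼-trans x∼y y∼a) x≁a
  ...   | in-c _ y∼c    = contradiction (∼-trans x∼y y∼c) x≁c
  ...   | elsewhere _ _ = x∼y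

  swap-involutive : ∀ x → swap (swap x) ∼ x
  swap-involutive x with position x
  ... | in-a x∼a   = ∼-trans (∼-reflexive (swap-on-c ∼-refl)) (∼-sym x∼a)
  ... | in-c _ x∼c = ∼-trans (∼-reflexive (swap-on-a ∼-refl)) (∼-sym x∼c)
  ... | elsewhere x≁a x≁c with position x  -- swap x is x itself; reduce swap x once more
  ...   | in-a x∼a      = contradiction x∼a x≁a
  ...   | in-c _ x∼c    = contradiction x∼c x≁c
  ...   | elsewhere _ _ = ∼-refl

  swap-reflect : ∀ {x y} → swap x ∼ swap y → x ∼ y
  swap-reflect {x} {y} sx∼sy =
    ∼-trans (∼-sym (swap-involutive x)) (∼-trans (swap-resp sx∼sy) (swap-involutive y))

  swap-closed : (S : A → Set) → S a → S c → ∀ {x} → S x → S (swap x)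
  swap-closed S Sa Sc {x} Sx with position x
  ... | in-a _        = Sc
  ... | in-c _ _      = Sa
  ... | elsewhere _ _ = Sx

-- Ideals of a ring whose additive structure is an abelian group

module IdealTheory
  (𝓡 : RawRing 0ℓ 0ℓ)
  (+-isAbelianGroup : IsAbelianGroup (RawRing._≈_ 𝓡) (RawRing._+_ 𝓡) (RawRing.0# 𝓡) (RawRing.-_ 𝓡))
  where

  open RawRing 𝓡 renaming (Carrier to R)
  open RingNotions 𝓡

  +-abelianGroup : AbelianGroup 0ℓ 0ℓ
  +-abelianGroup = record { isAbelianGroup = +-isAbelianGroup }

  open AbelianGroup +-abelianGroup
    using (setoid; assoc; ∙-cong; ∙-congˡ; identityˡ; identityʳ; inverseʳ)
    renaming (refl to ≈-refl; sym to ≈-sym; trans to ≈-trans)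
  open AbelianGroupProperties +-abelianGroup
    using (ε⁻¹≈ε; xyx⁻¹≈y; ⁻¹-anti-homo-//; //-rightDividesˡ; identityˡ-unique)
  open SetoidReasoning setoid

  module _ {I : Subset} (ideal : IsIdeal I) where
    open IsIdeal ideal

    ∼-isEquivalence : IsEquivalence (λ x y → x ∼[ I ] y)
    ∼-isEquivalence = record
      { refl  = λ {x} → resp (≈-sym (inverseʳ x)) zero∈
      ; sym   = λ {x} {y} x∼y → resp (⁻¹-anti-homo-// x y) (neg-closed x∼y)
      ; trans = λ {x} {y} {z} x∼y y∼z → resp (difference-chain x y z) (+-closed x∼y y∼z)
      }
      where
        difference-chain : ∀ x y z → (x + - y) + (y + - z) ≈ x + - z
        difference-chain x y z = begin
          (x + - y) + (y + - z) ≈⟨ assoc (x + - y) y (- z) ⟨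
          ((x + - y) + y) + - z ≈⟨ ∙-cong (//-rightDividesˡ y x) ≈-refl ⟩
          x + - z               ∎

    ∼0⇒∈ : ∀ {x} → x ∼[ I ] 0# → I x
    ∼0⇒∈ {x} = resp (≈-trans (∙-congˡ ε⁻¹≈ε) (identityʳ x))

    translate-∼ : ∀ {x} u → I x → (u + x) ∼[ I ] u
    translate-∼ {x} u x∈I = resp (≈-sym (xyx⁻¹≈y u x)) x∈I

  IsUnit : R → Set
  IsUnit x = ∃ λ c → c * x ≈ 1#

  unit∉proper : ∀ {I x} → IsIdeal I → Proper I → IsUnit x → ¬ I x
  unit∉proper ideal proper (c , cx≈1) x∈I = proper (resp cx≈1 (absorb c x∈I))
    where open IsIdeal ideal

  -- additive maps fix 0, so 0 lies in every extended submonoid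
  0#-fixed : FixedByAut 0#
  0#-fixed f aut = identityˡ-unique (f 0#) (f 0#) (begin
      f 0# + f 0#   ≈⟨ +-hom 0# 0# ⟨
      f (0# + 0#)   ≈⟨ f-cong (identityˡ 0#) ⟩
      f 0#          ∎)
    where open IsAutomorphism aut using (+-hom) renaming (cong to f-cong)

  -- the lifting clause in the definition of a covering ideal (via M̂)
  LiftsQuotPerms : Subset → Subset → Set
  LiftsQuotPerms I M̂ =
    ∀ g → IsQuotPerm I g → QuotStabilizes I M̂ g →
      ∃ λ g̃ → IsPerm g̃ × Stabilizes M̂ g̃ × (∀ {x} → M̂ x → g̃ x ∼[ I ] g x)

  -- Lift the swap of the classes of 0 and u: its lift maps u and b into M̂ ∩ I.
  covering-collapses :
    Substitutive _≈_ 0ℓ →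
    ∀ {I M̂} → IsIdeal I → DecidablePred I → IsExtendedSubmonoid M̂ → LiftsQuotPerms I M̂ →
    (∀ {x} → M̂ x → I x → x ≈ 0#) →
    ∀ {u b} → M̂ u → M̂ b → ¬ I u → u ∼[ I ] b → u ≈ b
  covering-collapses ≈-subst {I} {M̂} ideal I? M̂-ext lifts M̂∩I≈0 {u} {b} M̂u M̂b u∉I u∼b =
    collapse (lifts swap (record { wd = swap-resp ; inj = swap-reflect ; surj = onto })
                         (record { image⊆ = image ; ⊆image = preimage }))
    where
      open IsEquivalence (∼-isEquivalence ideal)
        renaming (refl to ∼-refl; sym to ∼-sym; trans to ∼-trans; reflexive to ∼-reflexive)
      open IsExtendedSubmonoid M̂-ext using (fixed⊆)

      0≁u : ¬ 0# ∼[ I ] u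
      0≁u 0∼u = u∉I (∼0⇒∈ ideal (∼-sym 0∼u))

      open ClassSwap (∼-isEquivalence ideal) (λ x y → I? (x + - y)) 0≁u

      M̂0 : M̂ 0#
      M̂0 = fixed⊆ 0#-fixed

      onto : ∀ y → ∃ λ x → swap x ∼[ I ] y
      onto y = swap y , swap-involutive y

      image : ∀ {x} → M̂ x → ∃ λ y → M̂ y × (swap x ∼[ I ] y)
      image {x} M̂x = swap x , swap-closed M̂ M̂0 M̂u M̂x , ∼-refl

      preimage : ∀ {y} → M̂ y → ∃ λ x → M̂ x × (swap x ∼[ I ] y)
      preimage {y} M̂y = swap y , swap-closed M̂ M̂0 M̂u M̂y , swap-involutive y

      collapse : (∃ λ g̃ → IsPerm g̃ × Stabilizes M̂ g̃ × (∀ {x} → M̂ x → g̃ x ∼[ I ] swap x)) → u ≈ b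
      collapse (g̃ , g̃-perm , g̃-stab , g̃∼swap) = begin
          u             ≈⟨ invˡ u ⟨
          inv (g̃ u)     ≈⟨ ≈-subst (λ z → inv (g̃ u) ≈ inv z) g̃u≈g̃b ≈-refl ⟩
          inv (g̃ b)     ≈⟨ invˡ b ⟩
          b             ∎
        where
          open IsPerm g̃-perm using (inv; invˡ)

          -- the class of u is sent to the class of 0, i.e. into M̂ ∩ I = {0}
          lands-on-0 : ∀ {x} → M̂ x → x ∼[ I ] u → g̃ x ≈ 0#
          lands-on-0 {x} M̂x x∼u =
            M̂∩I≈0 (Stabilizes.image⊆ g̃-stab M̂x)
                  (∼0⇒∈ ideal (∼-trans (g̃∼swap M̂x) (∼-reflexive (swap-on-c x∼u))))

          g̃u≈g̃b : g̃ u ≈ g̃ b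
          g̃u≈g̃b = ≈-trans (lands-on-0 M̂u ∼-refl) (≈-sym (lands-on-0 M̂b (∼-sym u∼b)))

-- Arithmetic in 𝔽ₚ = Fin p

module PrimeField (p : ℕ) (pr : Prime p) where
  open import Data.Nat using (_+_; _*_; _∸_; _%_)

  private instance
    p≢0 : NonZero p
    p≢0 = prime⇒nonZero pr

  open ≡-Reasoning

  infixl 6 _+ₚ_
  infixl 7 _*ₚ_

  _+ₚ_ _*ₚ_ : Fin p → Fin p → Fin p
  _+ₚ_ = addₚ p pr
  _*ₚ_ = mulₚ p pr

  -ₚ_ : Fin p → Fin p
  -ₚ_ = negₚ p pr

  0ₚ 1ₚ : Fin p
  0ₚ = 0 mod p
  1ₚ = 1 mod p

  -- Reduction  k ↦ k mod p  is a surjection ℕ → 𝔽ₚ compatible with + and *;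
  -- the field laws are pulled back from ℕ along it.
  toℕ-mod : ∀ k → toℕ (k mod p) ≡ k % p
  toℕ-mod k = toℕ-fromℕ< _

  mod-cong : ∀ {k l} → k % p ≡ l % p → k mod p ≡ l mod p
  mod-cong eq = fromℕ<-cong _ _ eq _ _

  mod-toℕ : ∀ a → toℕ a mod p ≡ a
  mod-toℕ a = toℕ-injective (trans (toℕ-mod (toℕ a)) (m<n⇒m%n≡m (toℕ<n a)))

  mod-+ : ∀ k l → (k mod p) +ₚ (l mod p) ≡ (k + l) mod p
  mod-+ k l = mod-cong (begin
    (toℕ (k mod p) + toℕ (l mod p)) % p ≡⟨ cong₂ (λ i j → (i + j) % p) (toℕ-mod k) (toℕ-mod l) ⟩
    (k % p + l % p) % p                 ≡⟨ %-distribˡ-+ k l p ⟨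
    (k + l) % p                         ∎)

  mod-* : ∀ k l → (k mod p) *ₚ (l mod p) ≡ (k * l) mod p
  mod-* k l = mod-cong (begin
    (toℕ (k mod p) * toℕ (l mod p)) % p ≡⟨ cong₂ (λ i j → (i * j) % p) (toℕ-mod k) (toℕ-mod l) ⟩
    (k % p * (l % p)) % p               ≡⟨ %-distribˡ-* k l p ⟨
    (k * l) % p                         ∎)

  +ₚ-comm : ∀ a b → a +ₚ b ≡ b +ₚ a
  +ₚ-comm a b = cong (_mod p) (+-comm (toℕ a) (toℕ b))

  *ₚ-comm : ∀ a b → a *ₚ b ≡ b *ₚ a
  *ₚ-comm a b = cong (_mod p) (*-comm (toℕ a) (toℕ b))

  +ₚ-assoc : ∀ a b c → (a +ₚ b) +ₚ c ≡ a +ₚ (b +ₚ c)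
  +ₚ-assoc a b c = begin
    (a +ₚ b) +ₚ c                      ≡⟨ cong ((a +ₚ b) +ₚ_) (mod-toℕ c) ⟨
    (a +ₚ b) +ₚ (toℕ c mod p)          ≡⟨ mod-+ (toℕ a + toℕ b) (toℕ c) ⟩
    (toℕ a + toℕ b + toℕ c) mod p      ≡⟨ cong (_mod p) (+-assoc (toℕ a) (toℕ b) (toℕ c)) ⟩
    (toℕ a + (toℕ b + toℕ c)) mod p    ≡⟨ mod-+ (toℕ a) (toℕ b + toℕ c) ⟨
    (toℕ a mod p) +ₚ (b +ₚ c)          ≡⟨ cong (_+ₚ (b +ₚ c)) (mod-toℕ a) ⟩
    a +ₚ (b +ₚ c)                      ∎

  +ₚ-identityʳ : ∀ a → a +ₚ 0ₚ ≡ a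
  +ₚ-identityʳ a = begin
    a +ₚ 0ₚ                 ≡⟨ cong (_+ₚ 0ₚ) (mod-toℕ a) ⟨
    (toℕ a mod p) +ₚ 0ₚ     ≡⟨ mod-+ (toℕ a) 0 ⟩
    (toℕ a + 0) mod p       ≡⟨ cong (_mod p) (+-identityʳ (toℕ a)) ⟩
    toℕ a mod p             ≡⟨ mod-toℕ a ⟩
    a                       ∎

  +ₚ-identityˡ : ∀ a → 0ₚ +ₚ a ≡ a
  +ₚ-identityˡ a = trans (+ₚ-comm 0ₚ a) (+ₚ-identityʳ a)

  +ₚ-inverseʳ : ∀ a → a +ₚ -ₚ a ≡ 0ₚ
  +ₚ-inverseʳ a = begin
    a +ₚ -ₚ a                   ≡⟨ cong (_+ₚ -ₚ a) (mod-toℕ a) ⟨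
    (toℕ a mod p) +ₚ -ₚ a       ≡⟨ mod-+ (toℕ a) (p ∸ toℕ a) ⟩
    (toℕ a + (p ∸ toℕ a)) mod p ≡⟨ cong (_mod p) (m+[n∸m]≡n (<⇒≤ (toℕ<n a))) ⟩
    p mod p                     ≡⟨ mod-cong ([m+n]%n≡m%n 0 p) ⟩
    0ₚ                          ∎

  +ₚ-inverseˡ : ∀ a → -ₚ a +ₚ a ≡ 0ₚ
  +ₚ-inverseˡ a = trans (+ₚ-comm (-ₚ a) a) (+ₚ-inverseʳ a)

  *ₚ-zeroˡ : ∀ a → 0ₚ *ₚ a ≡ 0ₚ
  *ₚ-zeroˡ a = trans (cong (0ₚ *ₚ_) (sym (mod-toℕ a))) (mod-* 0 (toℕ a))

  *ₚ-zeroʳ : ∀ a → a *ₚ 0ₚ ≡ 0ₚ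
  *ₚ-zeroʳ a = trans (*ₚ-comm a 0ₚ) (*ₚ-zeroˡ a)

  IsNonzero : Fin p → Set
  IsNonzero a = toℕ a ≢ 0

  residue-zero : ∀ {k} → k < p → p ∣ k → k ≡ 0
  residue-zero {zero}  _   _   = refl
  residue-zero {suc k} k<p p∣k = contradiction p∣k (>⇒∤ k<p)

  toℕ-mod≡0⇒∣ : ∀ k → toℕ (k mod p) ≡ 0 → p ∣ k
  toℕ-mod≡0⇒∣ k eq = m%n≡0⇒n∣m k p (trans (sym (toℕ-mod k)) eq)

  toℕ-0ₚ : toℕ 0ₚ ≡ 0
  toℕ-0ₚ = trans (toℕ-mod 0) (m<n⇒m%n≡m (>-nonZero⁻¹ p))

  toℕ-1ₚ : toℕ 1ₚ ≡ 1
  toℕ-1ₚ = trans (toℕ-mod 1) (m<n⇒m%n≡m (nonTrivial⇒n>1 p {{prime⇒nonTrivial pr}}))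

  1ₚ-nonzero : IsNonzero 1ₚ
  1ₚ-nonzero 1ₚ≡0 = 1+n≢0 (trans (sym toℕ-1ₚ) 1ₚ≡0)

  *ₚ-nonzero : ∀ {a b} → IsNonzero a → IsNonzero b → IsNonzero (a *ₚ b)
  *ₚ-nonzero {a} {b} a≢0 b≢0 ab≡0 with euclidsLemma (toℕ a) (toℕ b) pr (toℕ-mod≡0⇒∣ _ ab≡0)
  ... | inj₁ p∣a = a≢0 (residue-zero (toℕ<n a) p∣a)
  ... | inj₂ p∣b = b≢0 (residue-zero (toℕ<n b) p∣b)

  nonzero-coprime : ∀ {a} → IsNonzero a → Coprime (toℕ a) p
  nonzero-coprime {a} a≢0 (d∣a , d∣p) with prime⇒irreducible pr d∣p
  ... | inj₁ d≡1 = d≡1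
  ... | inj₂ refl = contradiction (residue-zero (toℕ<n a) d∣a) a≢0

  *ₚ-inverse : ∀ {a} → IsNonzero a → ∃ λ c → c *ₚ a ≡ 1ₚ
  *ₚ-inverse {a} a≢0 with coprime-Bézout (nonzero-coprime a≢0)
  ... | Bézout.+- x y 1+yp≡xa = x mod p , (begin
    (x mod p) *ₚ a                   ≡⟨ cong ((x mod p) *ₚ_) (mod-toℕ a) ⟨
    (x mod p) *ₚ (toℕ a mod p)       ≡⟨ mod-* x (toℕ a) ⟩
    (x * toℕ a) mod p                ≡⟨ cong (_mod p) 1+yp≡xa ⟨
    (1 + y * p) mod p                ≡⟨ mod-cong ([m+kn]%n≡m%n 1 y p) ⟩
    1ₚ                               ∎)
  ... | Bézout.-+ x y 1+xa≡yp = (x * t) mod p , (begin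
    ((x * t) mod p) *ₚ a             ≡⟨ cong (((x * t) mod p) *ₚ_) (mod-toℕ a) ⟨
    ((x * t) mod p) *ₚ (toℕ a mod p) ≡⟨ mod-* (x * t) (toℕ a) ⟩
    (x * t * toℕ a) mod p            ≡⟨ cong (_mod p) (square x (toℕ a)) ⟩
    (t * t) mod p                    ≡⟨ mod-cong ([m+kn]%n≡m%n (t * t) (y + y) p) ⟨
    (t * t + (y + y) * p) mod p      ≡⟨ cong (λ z → (t * t + z) mod p) (*-distribʳ-+ p y y) ⟩
    (t * t + (y * p + y * p)) mod p  ≡⟨ cong (_mod p) (complete-square 1+xa≡yp) ⟩
    (1 + y * p * (y * p)) mod p      ≡⟨ cong (λ z → (1 + z) mod p) (*-assoc (y * p) y p) ⟨
    (1 + y * p * y * p) mod p        ≡⟨ mod-cong ([m+kn]%n≡m%n 1 (y * p * y) p) ⟩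
    1ₚ                               ∎)
    where
      -- here  x·a ≡ -1 (mod p), so  (x·a)² ≡ 1  and  x·(x·a)  inverts a
      t : ℕ
      t = x * toℕ a
      square : ∀ x a → x * (x * a) * a ≡ x * a * (x * a)
      square = solve-∀
      completion : ∀ t → t * t + ((1 + t) + (1 + t)) ≡ 1 + (1 + t) * (1 + t)
      completion = solve-∀
      complete-square : ∀ {t s} → 1 + t ≡ s → t * t + (s + s) ≡ 1 + s * s
      complete-square {t} refl = completion t

  -- For odd p every residue a can be shifted by a nonzero c to a nonzero c + a:
  -- take c = 1 when a = 0, and c = a otherwise (then c + a = 2a ≠ 0).
  nonzero-shift : 2 < p → ∀ a → ∃ λ c → IsNonzero c × IsNonzero (c +ₚ a)
  nonzero-shift 2<p a with toℕ a ≟ 0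
  ... | yes a≡0 = 1ₚ , 1ₚ-nonzero , λ 1+a≡0 → 1ₚ-nonzero (begin
    toℕ 1ₚ                 ≡⟨ toℕ-mod 1 ⟩
    1 % p                  ≡⟨ cong₂ (λ i j → (i + j) % p) toℕ-1ₚ a≡0 ⟨
    (toℕ 1ₚ + toℕ a) % p   ≡⟨ toℕ-mod (toℕ 1ₚ + toℕ a) ⟨
    toℕ (1ₚ +ₚ a)          ≡⟨ 1+a≡0 ⟩
    0                      ∎)
  ... | no a≢0 = a , a≢0 , λ 2a≡0 →
    [ (λ p∣2 → <⇒≱ 2<p (∣⇒≤ p∣2)) , (λ p∣a → a≢0 (residue-zero (toℕ<n a) p∣a)) ]′
      (euclidsLemma 2 (toℕ a) pr (subst (p ∣_) (double (toℕ a)) (toℕ-mod≡0⇒∣ _ 2a≡0)))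
    where
      double : ∀ n → n + n ≡ 2 * n
      double = solve-∀

-- Permuting the coordinates of a vector

module _ {A : Set} where

  vec-ext : ∀ {n} {x y : Vec A n} → (∀ k → lookup x k ≡ lookup y k) → x ≡ y
  vec-ext {x = x} {y} pointwise =
    trans (sym (tabulate∘lookup x)) (trans (tabulate-cong pointwise) (tabulate∘lookup y))

  permute : ∀ {n} → Permutation′ n → Vec A n → Vec A n
  permute π x = tabulate (λ k → lookup x (π ⟨$⟩ʳ k))

  lookup-permute : ∀ {n} (π : Permutation′ n) x k → lookup (permute π x) k ≡ lookup x (π ⟨$⟩ʳ k)
  lookup-permute π x k = lookup∘tabulate (λ k → lookup x (π ⟨$⟩ʳ k)) k

  permute-zipWith : ∀ {n} (f : A → A → A) (π : Permutation′ n) x y →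
                    permute π (zipWith f x y) ≡ zipWith f (permute π x) (permute π y)
  permute-zipWith f π x y = vec-ext λ k → begin
    lookup (permute π (zipWith f x y)) k                ≡⟨ lookup-permute π (zipWith f x y) k ⟩
    lookup (zipWith f x y) (π ⟨$⟩ʳ k)                   ≡⟨ lookup-zipWith f (π ⟨$⟩ʳ k) x y ⟩
    f (lookup x (π ⟨$⟩ʳ k)) (lookup y (π ⟨$⟩ʳ k))       ≡⟨ cong₂ f (lookup-permute π x k) (lookup-permute π y k) ⟨
    f (lookup (permute π x) k) (lookup (permute π y) k) ≡⟨ lookup-zipWith f k (permute π x) (permute π y) ⟨
    lookup (zipWith f (permute π x) (permute π y)) k    ∎
    where open ≡-Reasoning

  permute-replicate : ∀ n (π : Permutation′ n) a → permute π (replicate n a) ≡ replicate n a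
  permute-replicate n π a = vec-ext λ k →
    trans (lookup-permute π (replicate n a) k) (trans (lookup-replicate (π ⟨$⟩ʳ k) a) (sym (lookup-replicate k a)))

  permute-flipˡ : ∀ {n} (π : Permutation′ n) x → permute (flip π) (permute π x) ≡ x
  permute-flipˡ π x = vec-ext λ k →
    trans (lookup-permute (flip π) (permute π x) k) (trans (lookup-permute π x _) (cong (lookup x) (permutation-inverseʳ π)))

  permute-flipʳ : ∀ {n} (π : Permutation′ n) x → permute π (permute (flip π) x) ≡ x
  permute-flipʳ π x = vec-ext λ k →
    trans (lookup-permute π (permute (flip π) x) k) (trans (lookup-permute (flip π) x _) (cong (lookup x) (permutation-inverseˡ π)))

-- The coordinate ring 𝔽ₚⁿ and its submonoid of units and zero

module CoordinateRing (p : ℕ) (pr : Prime p) (n : ℕ) where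
  open PrimeField p pr
  open RawRing (Fpⁿ p pr n) renaming (Carrier to R)
  open RingNotions (Fpⁿ p pr n)

  +-isAbelianGroup : IsAbelianGroup _≡_ _+_ 0# -_
  +-isAbelianGroup = record
    { isGroup = record
      { isMonoid = record
        { isSemigroup = record
          { isMagma = record { isEquivalence = isEquivalence ; ∙-cong = cong₂ _+_ }
          ; assoc   = zipWith-assoc +ₚ-assoc
          }
        ; identity = zipWith-identityˡ +ₚ-identityˡ , zipWith-identityʳ +ₚ-identityʳ
        }
      ; inverse = zipWith-inverseˡ +ₚ-inverseˡ , zipWith-inverseʳ +ₚ-inverseʳ
      ; ⁻¹-cong = cong -_
      }
    ; comm = zipWith-comm +ₚ-comm
    }

  open IdealTheory (Fpⁿ p pr n) +-isAbelianGroup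
  open AbelianGroupProperties +-abelianGroup using (identityʳ-unique)

  AllNonzero : R → Set
  AllNonzero x = ∀ k → IsNonzero (lookup x k)

  allNonzero⇒unit : ∀ {x} → AllNonzero x → IsUnit x
  allNonzero⇒unit {x} x≢0 = c , vec-ext λ k → begin
      lookup (c * x) k           ≡⟨ lookup-zipWith _*ₚ_ k c x ⟩
      lookup c k *ₚ lookup x k   ≡⟨ cong (_*ₚ lookup x k) (lookup∘tabulate inverse k) ⟩
      inverse k *ₚ lookup x k    ≡⟨ proj₂ (*ₚ-inverse (x≢0 k)) ⟩
      1ₚ                         ≡⟨ lookup-replicate k 1ₚ ⟨
      lookup 1# k                ∎
    where
      open ≡-Reasoning
      inverse : Fin n → Fin p
      inverse k = proj₁ (*ₚ-inverse (x≢0 k))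
      c : R
      c = tabulate inverse

  UnitOrZero : Subset
  UnitOrZero x = AllNonzero x ⊎ x ≡ 0#

  unitOrZero-*-closed : ∀ {x y} → UnitOrZero x → UnitOrZero y → UnitOrZero (x * y)
  unitOrZero-*-closed {x} {y} (inj₁ x≢0) (inj₁ y≢0) = inj₁ λ k xy≡0 →
    *ₚ-nonzero (x≢0 k) (y≢0 k) (trans (cong toℕ (sym (lookup-zipWith _*ₚ_ k x y))) xy≡0)
  unitOrZero-*-closed {x} {y} (inj₂ refl) _           = inj₂ (zipWith-zeroˡ *ₚ-zeroˡ y)
  unitOrZero-*-closed {x} {y} (inj₁ _)    (inj₂ refl) = inj₂ (zipWith-zeroʳ *ₚ-zeroʳ x)

  -- a proper ideal contains no unit, so it meets UnitOrZero only in 0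
  unitOrZero∩ideal : ∀ {I x} → IsIdeal I → Proper I → UnitOrZero x → I x → x ≡ 0#
  unitOrZero∩ideal ideal proper (inj₁ x≢0) x∈I =
    contradiction x∈I (unit∉proper ideal proper (allNonzero⇒unit x≢0))
  unitOrZero∩ideal ideal proper (inj₂ x≡0) x∈I = x≡0

  unit-shift : 2 < p → ∀ x → ∃ λ u → AllNonzero u × AllNonzero (u + x)
  unit-shift 2<p x = u , (λ k → subst IsNonzero (sym (lookup-u k)) (proj₁ (proj₂ (shift k))))
                       , λ k → subst IsNonzero (sym (lookup-u+x k)) (proj₂ (proj₂ (shift k)))
    where
      shift : ∀ k → ∃ λ c → IsNonzero c × IsNonzero (c +ₚ lookup x k)
      shift k = nonzero-shift 2<p (lookup x k)
      u : R
      u = tabulate (proj₁ ∘ shift)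
      lookup-u : ∀ k → lookup u k ≡ proj₁ (shift k)
      lookup-u = lookup∘tabulate (proj₁ ∘ shift)
      lookup-u+x : ∀ k → lookup (u + x) k ≡ proj₁ (shift k) +ₚ lookup x k
      lookup-u+x k = trans (lookup-zipWith _+ₚ_ k u x) (cong (_+ₚ lookup x k) (lookup-u k))

  permute-isAutomorphism : ∀ π → IsAutomorphism (permute π)
  permute-isAutomorphism π = record
    { inv   = permute (flip π)
    ; cong  = cong (permute π)
    ; invˡ  = permute-flipˡ π
    ; invʳ  = permute-flipʳ π
    ; +-hom = permute-zipWith _+ₚ_ π
    ; *-hom = permute-zipWith _*ₚ_ π
    ; 1-hom = permute-replicate n π 1ₚ
    }

  -- For odd p no proper nonzero ideal covers UnitOrZero: with 0 ≠ x₀ ∈ I and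
  -- units u, u + x₀, covering-collapses would force u = u + x₀.
  no-covering-ideal : 2 < p → ∀ {I} → IsIdeal I → Proper I → Nonzero I → ¬ IsCoveringIdeal UnitOrZero I
  no-covering-ideal 2<p {I} ideal proper (x₀ , x₀∈I , x₀≢0) (M̂ , M̂-ext , M̂⊆M , M∖M̂⊆I , lifts) =
    ¬¬-in-M̂ u≢0 λ M̂u → ¬¬-in-M̂ b≢0 λ M̂b → ¬¬-decidable (fin-dnShift p) I λ I? →
    x₀≢0 (identityʳ-unique u x₀
      (sym (covering-collapses subst ideal I? M̂-ext lifts M̂∩I≡0 M̂u M̂b u∉I u∼b)))
    where
      open IsEquivalence (∼-isEquivalence ideal) using () renaming (sym to ∼-sym)

      shifted : ∃ λ u → AllNonzero u × AllNonzero (u + x₀)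
      shifted = unit-shift 2<p x₀
      u : R
      u = proj₁ shifted
      u≢0 : AllNonzero u
      u≢0 = proj₁ (proj₂ shifted)
      b≢0 : AllNonzero (u + x₀)
      b≢0 = proj₂ (proj₂ shifted)

      -- units outside M̂ would lie in the proper ideal I
      ¬¬-in-M̂ : ∀ {x} → AllNonzero x → ¬ ¬ M̂ x
      ¬¬-in-M̂ x≢0 x∉M̂ = unit∉proper ideal proper (allNonzero⇒unit x≢0) (M∖M̂⊆I (inj₁ x≢0) x∉M̂)

      M̂∩I≡0 : ∀ {x} → M̂ x → I x → x ≡ 0#
      M̂∩I≡0 M̂x = unitOrZero∩ideal ideal proper (M̂⊆M M̂x)

      u∉I : ¬ I u
      u∉I = unit∉proper ideal proper (allNonzero⇒unit u≢0)

      u∼b : u ∼[ I ] (u + x₀)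
      u∼b = ∼-sym (translate-∼ ideal u x₀∈I)

-- For n ≥ 1, coordinate transpositions show that fixed vectors are constant,
-- so UnitOrZero contains R^{Aut(R)} and is an extended submonoid.
module FixedPoints (p : ℕ) (pr : Prime p) (m : ℕ) where
  open PrimeField p pr
  open CoordinateRing p pr (suc m)
  open RawRing (Fpⁿ p pr (suc m)) using (0#)
  open RingNotions (Fpⁿ p pr (suc m))

  fixed⇒constant : ∀ {x} → FixedByAut x → ∀ j → lookup x j ≡ lookup x zero
  fixed⇒constant {x} fixed j =
    trans (sym (lookup-permute (transpose zero j) x zero))
          (cong (λ y → lookup y zero) (fixed (permute (transpose zero j)) (permute-isAutomorphism (transpose zero j))))

  fixed⇒unitOrZero : ∀ {x} → FixedByAut x → UnitOrZero x
  fixed⇒unitOrZero {x} fixed with toℕ (lookup x zero) ≟ 0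
  ... | no x₀≢0  = inj₁ λ j → subst IsNonzero (sym (fixed⇒constant fixed j)) x₀≢0
  ... | yes x₀≡0 = inj₂ (vec-ext λ j → toℕ-injective (begin
      toℕ (lookup x j)      ≡⟨ cong toℕ (fixed⇒constant fixed j) ⟩
      toℕ (lookup x zero)   ≡⟨ x₀≡0 ⟩
      0                     ≡⟨ toℕ-0ₚ ⟨
      toℕ 0ₚ                ≡⟨ cong toℕ (lookup-replicate j 0ₚ) ⟨
      toℕ (lookup 0# j)     ∎))
    where open ≡-Reasoning

  unitOrZero-isExtendedSubmonoid : IsExtendedSubmonoid UnitOrZero
  unitOrZero-isExtendedSubmonoid = record
    { one∈     = inj₁ λ k → subst IsNonzero (sym (lookup-replicate k 1ₚ)) 1ₚ-nonzero
    ; *-closed = unitOrZero-*-closed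
    ; fixed⊆   = fixed⇒unitOrZero
    }

proposition5 : (p : ℕ) (pr : Prime p) → 2 < p → (n : ℕ) → 1 ≤ n →
    ¬ RingNotions.IsMonoidalNetwork (Fpⁿ p pr n)
proposition5 p pr 2<p (suc m) _ network =
  let (I , ideal , proper , nonzero , covering) = network UnitOrZero unitOrZero-isExtendedSubmonoid
  in  no-covering-ideal 2<p ideal proper nonzero covering
  where
    open CoordinateRing p pr (suc m)
    open FixedPoints p pr m
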